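{- Consider the Fitch-style calculus for Intuitionistic S4 interpreted in a cartesian closed category $\mathcal{C}$ with an adjunction $\Diamond\dashv\Box$ in which $\Box$ is an idempotent comonad. Let $D$ be a derivation of $\Gamma,\Gamma'\vdash t:A$ such that no variable of $\Gamma'$ is free in $t$, let $D'$ be the derivation of $\Gamma\vdash t:A$ obtained by strengthening away $\Gamma'$, and let $\Gamma''$ be any context with $\Gamma,\Gamma',\Gamma''$ well formed. Then \[ \Diamond[\![D]\!]\circ(l_{\Gamma''})_{[\![\Gamma,\Gamma']\!]} \;=\; \Diamond[\![D']\!]\circ(l_{\Gamma',\Gamma''})_{[\![\Gamma]\!]} \quad:\ [\![\Gamma,\Gamma',\Gamma'']\!]\to\Diamond[\![A]\!]. \]
   Context: Calculus: types $A,B ::= p \mid 1 \mid A\times B \mid A\to B \mid \Box A$; contexts $\Gamma ::= \cdot \mid \Gamma,x:A \mid \Gamma,\bullet$ ($\bullet$ a structural symbol called a lock). Rules: (var) $\Gamma,x:A,\Gamma'\vdash x:A$ provided $\Gamma'$ contains no lock; usual rules for $1,\times,\to$; (shut) from $\Gamma,\bullet\vdash t:A$ infer $\Gamma\vdash\mathrm{shut}\,t:\Box A$; (open) from $\Gamma\vdash t:\Box A$ infer $\Gamma,\Gamma'\vdash\mathrm{open}\,t:A$ for any context $\Gamma'$. Strengthening: if $D$ derives $\Gamma,\Delta,\Gamma_0\vdash t:B$ and no variable of $\Delta$ is free in $t$, the strengthened derivation of $\Gamma,\Gamma_0\vdash t:B$ is obtained by deleting these occurrences of the entries of $\Delta$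 (variables and locks) from every sequent of $D$ in which they occur. Semantics: $(\Diamond,\eta,\mu)$ is the monad induced by the comonad $\Box$ via the adjunction (unit $\eta^m$, counit $\varepsilon^m$); idempotence means each $\mu_X$ is an isomorphism with inverse $\eta_{\Diamond X}=\Diamond\eta_X$. Types are interpreted via the cartesian closed structure and $\Box$ (atoms arbitrary). A context $\Gamma$ denotes an endofunctor: $[\![\cdot]\!]=\mathrm{Id}$, $[\![\Gamma,x:A]\!](X)=[\![\Gamma]\!](X)\times[\![A]\!]$, $[\![\Gamma,\bullet]\!](X)=\Diamond[\![\Gamma]\!](X)$, and the object $[\![\Gamma]\!]=[\![\Gamma]\!](1)$, so $[\![\Gamma,\Gamma']\!]=[\![\Gamma']\!]([\![\Gamma]\!])$. Lock replacement $l_\Gamma:[\![\Gamma]\!]\Rightarrow\Diamond$: $l_\cdot=\eta$, $(l_{\Gamma,x:A})_X=(l_\Gamma)_X\circ\mathrm{pr}$, $(l_{\Gamma,\bullet})_X=\mu_X\circ\Diamond(l_\Gamma)_X$. A derivation $D$ of $\Gamma\vdash t:A$ denotes $[\![D]\!]:[\![\Gamma]\!]\to[\![A]\!]$ by induction: variables by projections, $1,\times,\to$ by the cartesian closed structure, $[\![\mathrm{shut}\,t]\!]=\Box[\![t]\!]\circ\eta^m_{[\![\Gamma]\!]}$, and $[\![\Gamma,\Gamma'\vdash\mathrm{open}\,t]\!]=\varepsilon^m_{[\![A]\!]}\circ\Diamond[\![t]\!]\circ(l_{\Gamma'})_{[\![\Gamma]\!]}$. -}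

module Defs where

open import Level using (Level; _⊔_) renaming (suc to lsuc)
open import Data.Nat using (ℕ)
open import Data.Empty using (⊥; ⊥-elim)
open import Data.Sum using (_⊎_; inj₁; inj₂)
open import Data.Product using (Σ; _,_; Σ-syntax; ∃; ∃-syntax)
open import Data.Maybe using (Maybe; just; nothing; maybe)
open import Relation.Nullary using (¬_)
open import Relation.Binary.PropositionalEquality using (_≡_; _≢_; refl; cong)
open import Relation.Binary.Structures using (IsEquivalence)

infixr 7 _→ₜ_
infixr 8 _×ₜ_

data Ty : Set where
  ι     : ℕ → Ty
  𝟏     : Ty
  _×ₜ_  : Ty → Ty → Ty
  _→ₜ_  : Ty → Ty → Ty
  □ₜ    : Ty → Ty

infixl 5 _▹_ _,🔒

data Ctx : Set where
  ∅    : Ctx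
  _▹_  : Ctx → Ty → Ctx
  _,🔒 : Ctx → Ctx

infixl 4 _,,_
_,,_ : Ctx → Ctx → Ctx
Γ ,, ∅ = Γ
Γ ,, (Δ ▹ A) = (Γ ,, Δ) ▹ A
Γ ,, (Δ ,🔒) = (Γ ,, Δ) ,🔒

data Append : Ctx → Ctx → Ctx → Set where
  nil   : ∀ {Γ} → Append Γ ∅ Γ
  snoc  : ∀ {Γ Γ' Ψ A} → Append Γ Γ' Ψ → Append Γ (Γ' ▹ A) (Ψ ▹ A)
  snoc🔒 : ∀ {Γ Γ' Ψ} → Append Γ Γ' Ψ → Append Γ (Γ' ,🔒) (Ψ ,🔒)

append-trans : ∀ {Γ Γ' Γ'' Ψ₁ Ψ} → Append Γ Γ' Ψ₁ → Append Ψ₁ Γ'' Ψ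
             → Append Γ (Γ' ,, Γ'') Ψ
append-trans w₁ nil = w₁
append-trans w₁ (snoc w₂) = snoc (append-trans w₁ w₂)
append-trans w₁ (snoc🔒 w₂) = snoc🔒 (append-trans w₁ w₂)

-- variable rule: Γ , x:A , Γ' ⊢ x : A with Γ' lock-free
data Var : Ctx → Ty → Set where
  here  : ∀ {Γ A} → Var (Γ ▹ A) A
  there : ∀ {Γ A B} → Var Γ A → Var (Γ ▹ B) A

infix 3 _⊢_

-- derivations of Γ ⊢ t : A (the term t is the erasure of the derivation)
data _⊢_ : Ctx → Ty → Set where
  var   : ∀ {Γ A} → Var Γ A → Γ ⊢ A
  unit  : ∀ {Γ} → Γ ⊢ 𝟏
  pair  : ∀ {Γ A B} → Γ ⊢ A → Γ ⊢ B → Γ ⊢ A ×ₜ B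
  fst   : ∀ {Γ A B} → Γ ⊢ A ×ₜ B → Γ ⊢ A
  snd   : ∀ {Γ A B} → Γ ⊢ A ×ₜ B → Γ ⊢ B
  lam   : ∀ {Γ A B} → Γ ▹ A ⊢ B → Γ ⊢ A →ₜ B
  app   : ∀ {Γ A B} → Γ ⊢ A →ₜ B → Γ ⊢ A → Γ ⊢ B
  shut  : ∀ {Γ A} → Γ ,🔒 ⊢ A → Γ ⊢ □ₜ A
  opn   : ∀ {Γ Γ' Ψ A} → Append Γ Γ' Ψ → Γ ⊢ □ₜ A → Ψ ⊢ A

data Pos : Ctx → Set where
  here   : ∀ {Γ A} → Pos (Γ ▹ A)
  there  : ∀ {Γ A} → Pos Γ → Pos (Γ ▹ A)
  there🔒 : ∀ {Γ} → Pos Γ → Pos (Γ ,🔒)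

toPos : ∀ {Γ A} → Var Γ A → Pos Γ
toPos here = here
toPos (there v) = there (toPos v)

restrict : ∀ {Γ Γ' Ψ} → Append Γ Γ' Ψ → Pos Ψ → Maybe (Pos Γ)
restrict nil p = just p
restrict (snoc w) here = nothing
restrict (snoc w) (there p) = restrict w p
restrict (snoc🔒 w) (there🔒 p) = restrict w p

inR : ∀ {Γ Γ' Ψ} → Append Γ Γ' Ψ → Pos Γ' → Pos Ψ
inR (snoc w) here = here
inR (snoc w) (there p) = there (inR w p)
inR (snoc🔒 w) (there🔒 p) = there🔒 (inR w p)

inL : ∀ {Γ Γ' Ψ} → Append Γ Γ' Ψ → Pos Γ → Pos Ψ
inL nil p = p
inL (snoc w) p = there (inL w p)
inL (snoc🔒 w) p = there🔒 (inL w p)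

Free : ∀ {Γ A} → Γ ⊢ A → Pos Γ → Set
Free (var v) p = toPos v ≡ p
Free unit p = ⊥
Free (pair D E) p = Free D p ⊎ Free E p
Free (fst D) p = Free D p
Free (snd D) p = Free D p
Free (lam D) p = Free D (there p)
Free (app D E) p = Free D p ⊎ Free E p
Free (shut D) p = Free D (there🔒 p)
Free (opn w D) p = maybe (Free D) ⊥ (restrict w p)

strVar₀ : ∀ {Γ Δ Θ A} (w₁ : Append Γ Δ Θ) (v : Var Θ A)
        → (∀ p → toPos v ≢ inR w₁ p) → Var Γ A
strVar₀ nil v nf = v
strVar₀ (snoc w₁) here nf = ⊥-elim (nf here refl)
strVar₀ (snoc w₁) (there v) nf = strVar₀ w₁ v (λ p e → nf (there p) (cong there e))
strVar₀ (snoc🔒 w₁) () nf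

strVar : ∀ {Γ Δ Θ Γ₀ Ψ A} (w₁ : Append Γ Δ Θ) (w₂ : Append Θ Γ₀ Ψ) (v : Var Ψ A)
       → (∀ p → toPos v ≢ inL w₂ (inR w₁ p)) → Var (Γ ,, Γ₀) A
strVar w₁ nil v nf = strVar₀ w₁ v nf
strVar w₁ (snoc w₂) here nf = here
strVar w₁ (snoc w₂) (there v) nf = there (strVar w₁ w₂ v (λ p e → nf p (cong there e)))
strVar w₁ (snoc🔒 w₂) () nf

OpenData : Ctx → Ty → Set
OpenData Φ A = Σ[ Γ₁ ∈ Ctx ] Σ[ Γ₁' ∈ Ctx ] (Σ (Append Γ₁ Γ₁' Φ) λ _ → Γ₁ ⊢ □ₜ A)

strengthen : ∀ {Γ Δ Θ Γ₀ Ψ A} (w₁ : Append Γ Δ Θ) (w₂ : Append Θ Γ₀ Ψ) (D : Ψ ⊢ A)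
           → (∀ p → ¬ Free D (inL w₂ (inR w₁ p))) → Γ ,, Γ₀ ⊢ A
strOpen : ∀ {Γ Δ Θ Γ₀ Ψ Γ₁ Γ₁' A} (w₁ : Append Γ Δ Θ) (w₂ : Append Θ Γ₀ Ψ)
          (w : Append Γ₁ Γ₁' Ψ) (D : Γ₁ ⊢ □ₜ A)
        → (∀ p → ¬ Free (opn w D) (inL w₂ (inR w₁ p))) → OpenData (Γ ,, Γ₀) A

strengthen w₁ w₂ (var v) nf = var (strVar w₁ w₂ v nf)
strengthen w₁ w₂ unit nf = unit
strengthen w₁ w₂ (pair D E) nf =
  pair (strengthen w₁ w₂ D (λ p u → nf p (inj₁ u))) (strengthen w₁ w₂ E (λ p u → nf p (inj₂ u)))
strengthen w₁ w₂ (fst D) nf = fst (strengthen w₁ w₂ D nf)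
strengthen w₁ w₂ (snd D) nf = snd (strengthen w₁ w₂ D nf)
strengthen w₁ w₂ (lam D) nf = lam (strengthen w₁ (snoc w₂) D nf)
strengthen w₁ w₂ (app D E) nf =
  app (strengthen w₁ w₂ D (λ p u → nf p (inj₁ u))) (strengthen w₁ w₂ E (λ p u → nf p (inj₂ u)))
strengthen w₁ w₂ (shut D) nf = shut (strengthen w₁ (snoc🔒 w₂) D nf)
strengthen w₁ w₂ (opn w D) nf with strOpen w₁ w₂ w D nf
... | _ , _ , w' , D' = opn w' D'

strOpen w₁ w₂ nil D nf = _ , _ , nil , strengthen w₁ w₂ D nf
strOpen w₁ (snoc w₂) (snoc w) D nf with strOpen w₁ w₂ w D nf
... | _ , _ , w' , D' = _ , _ , snoc w' , D'
strOpen w₁ (snoc🔒 w₂) (snoc🔒 w) D nf with strOpen w₁ w₂ w D nf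
... | _ , _ , w' , D' = _ , _ , snoc🔒 w' , D'
strOpen nil nil (snoc w) D nf = _ , _ , snoc w , D
strOpen nil nil (snoc🔒 w) D nf = _ , _ , snoc🔒 w , D
strOpen (snoc w₁) nil (snoc w) D nf = strOpen w₁ nil w D (λ p → nf (there p))
strOpen (snoc🔒 w₁) nil (snoc🔒 w) D nf = strOpen w₁ nil w D (λ p → nf (there🔒 p))

record Model (o ℓ e : Level) : Set (lsuc (o ⊔ ℓ ⊔ e)) where
  infixr 9 _∘_
  infix  4 _≈_
  infixr 5 _⇒_
  infixr 7 _×_
  infixr 6 _⇨_
  field
    Obj : Set o
    _⇒_ : Obj → Obj → Set ℓ
    _≈_ : ∀ {A B} → A ⇒ B → A ⇒ B → Set e
    ≈-equiv : ∀ {A B} → IsEquivalence (_≈_ {A} {B})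
    id  : ∀ {A} → A ⇒ A
    _∘_ : ∀ {A B C} → B ⇒ C → A ⇒ B → A ⇒ C
    ∘-resp-≈  : ∀ {A B C} {f h : B ⇒ C} {g i : A ⇒ B} → f ≈ h → g ≈ i → f ∘ g ≈ h ∘ i
    identityˡ : ∀ {A B} {f : A ⇒ B} → id ∘ f ≈ f
    identityʳ : ∀ {A B} {f : A ⇒ B} → f ∘ id ≈ f
    assoc     : ∀ {A B C D} {f : A ⇒ B} {g : B ⇒ C} {h : C ⇒ D} → (h ∘ g) ∘ f ≈ h ∘ (g ∘ f)
    ⊤ : Obj
    ! : ∀ {A} → A ⇒ ⊤
    !-unique : ∀ {A} (f : A ⇒ ⊤) → ! ≈ f
    _×_ : Obj → Obj → Obj
    π₁ : ∀ {A B} → A × B ⇒ A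
    π₂ : ∀ {A B} → A × B ⇒ B
    ⟨_,_⟩ : ∀ {A B C} → C ⇒ A → C ⇒ B → C ⇒ A × B
    project₁ : ∀ {A B C} {f : C ⇒ A} {g : C ⇒ B} → π₁ ∘ ⟨ f , g ⟩ ≈ f
    project₂ : ∀ {A B C} {f : C ⇒ A} {g : C ⇒ B} → π₂ ∘ ⟨ f , g ⟩ ≈ g
    ⟨⟩-unique : ∀ {A B C} {f : C ⇒ A} {g : C ⇒ B} {h : C ⇒ A × B}
              → π₁ ∘ h ≈ f → π₂ ∘ h ≈ g → ⟨ f , g ⟩ ≈ h
    _⇨_ : Obj → Obj → Obj
    eval  : ∀ {B C} → (B ⇨ C) × B ⇒ C
    curry : ∀ {A B C} → A × B ⇒ C → A ⇒ B ⇨ C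
    β : ∀ {A B C} {f : A × B ⇒ C} → eval ∘ ⟨ curry f ∘ π₁ , π₂ ⟩ ≈ f
    curry-unique : ∀ {A B C} {f : A × B ⇒ C} {h : A ⇒ B ⇨ C}
                 → eval ∘ ⟨ h ∘ π₁ , π₂ ⟩ ≈ f → curry f ≈ h
    □ : Obj → Obj
    □₁ : ∀ {A B} → A ⇒ B → □ A ⇒ □ B
    □-identity : ∀ {A} → □₁ (id {A}) ≈ id
    □-homomorphism : ∀ {A B C} {f : A ⇒ B} {g : B ⇒ C} → □₁ (g ∘ f) ≈ □₁ g ∘ □₁ f
    □-resp-≈ : ∀ {A B} {f g : A ⇒ B} → f ≈ g → □₁ f ≈ □₁ g
    ◇ : Obj → Obj
    ◇₁ : ∀ {A B} → A ⇒ B → ◇ A ⇒ ◇ B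
    ◇-identity : ∀ {A} → ◇₁ (id {A}) ≈ id
    ◇-homomorphism : ∀ {A B C} {f : A ⇒ B} {g : B ⇒ C} → ◇₁ (g ∘ f) ≈ ◇₁ g ∘ ◇₁ f
    ◇-resp-≈ : ∀ {A B} {f g : A ⇒ B} → f ≈ g → ◇₁ f ≈ ◇₁ g
    ε : ∀ {A} → □ A ⇒ A
    δ : ∀ {A} → □ A ⇒ □ (□ A)
    ε-natural : ∀ {A B} {f : A ⇒ B} → ε ∘ □₁ f ≈ f ∘ ε
    δ-natural : ∀ {A B} {f : A ⇒ B} → δ ∘ □₁ f ≈ □₁ (□₁ f) ∘ δ
    comonad-identityˡ : ∀ {A} → ε {□ A} ∘ δ {A} ≈ id
    comonad-identityʳ : ∀ {A} → □₁ (ε {A}) ∘ δ {A} ≈ id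
    comonad-assoc : ∀ {A} → δ {□ A} ∘ δ {A} ≈ □₁ (δ {A}) ∘ δ {A}
    ηᵐ : ∀ {A} → A ⇒ □ (◇ A)
    εᵐ : ∀ {A} → ◇ (□ A) ⇒ A
    ηᵐ-natural : ∀ {A B} {f : A ⇒ B} → ηᵐ ∘ f ≈ □₁ (◇₁ f) ∘ ηᵐ
    εᵐ-natural : ∀ {A B} {f : A ⇒ B} → εᵐ ∘ ◇₁ (□₁ f) ≈ f ∘ εᵐ
    zig : ∀ {A} → εᵐ {◇ A} ∘ ◇₁ (ηᵐ {A}) ≈ id
    zag : ∀ {A} → □₁ (εᵐ {A}) ∘ ηᵐ {□ A} ≈ id

  -- the monad (◇, η, μ) induced by the comonad □ via the adjunction (mates of ε, δ)
  η : ∀ {X} → X ⇒ ◇ X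
  η {X} = ε {◇ X} ∘ ηᵐ {X}

  μ : ∀ {X} → ◇ (◇ X) ⇒ ◇ X
  μ {X} = εᵐ {◇ X} ∘ (◇₁ (εᵐ {□ (◇ X)}) ∘ (◇₁ (◇₁ (δ {◇ X})) ∘ ◇₁ (◇₁ (ηᵐ {X}))))

IsIdempotent : ∀ {o ℓ e} → Model o ℓ e → Set (o ⊔ e)
IsIdempotent M = ∀ {X : Obj} →
    (μ {X} ∘ η {◇ X} ≈ id) Data.Product.× (η {◇ X} ∘ μ {X} ≈ id)
    Data.Product.× (◇₁ (η {X}) ≈ η {◇ X})
  where open Model M

module Sem {o ℓ e} (M : Model o ℓ e) (P : ℕ → Model.Obj M) where
  open Model M

  ⟦_⟧ty : Ty → Obj
  ⟦ ι n ⟧ty = P n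
  ⟦ 𝟏 ⟧ty = ⊤
  ⟦ A ×ₜ B ⟧ty = ⟦ A ⟧ty × ⟦ B ⟧ty
  ⟦ A →ₜ B ⟧ty = ⟦ A ⟧ty ⇨ ⟦ B ⟧ty
  ⟦ □ₜ A ⟧ty = □ ⟦ A ⟧ty

  -- the endofunctor denoted by a context (on objects), and [[Γ]] = [[Γ]](1)
  ⟦_⟧F : Ctx → Obj → Obj
  ⟦ ∅ ⟧F X = X
  ⟦ Γ ▹ A ⟧F X = ⟦ Γ ⟧F X × ⟦ A ⟧ty
  ⟦ Γ ,🔒 ⟧F X = ◇ (⟦ Γ ⟧F X)

  ⟦_⟧ctx : Ctx → Obj
  ⟦ Γ ⟧ctx = ⟦ Γ ⟧F ⊤

  l : (Γ : Ctx) (X : Obj) → ⟦ Γ ⟧F X ⇒ ◇ X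
  l ∅ X = η
  l (Γ ▹ A) X = l Γ X ∘ π₁
  l (Γ ,🔒) X = μ ∘ ◇₁ (l Γ X)

  -- (l_Γ')_[[Γ]] : [[Γ,Γ']] → ◇[[Γ]], along the identification Ψ = Γ,Γ'
  lW : ∀ {Γ Γ' Ψ} → Append Γ Γ' Ψ → ⟦ Ψ ⟧ctx ⇒ ◇ ⟦ Γ ⟧ctx
  lW nil = η
  lW (snoc w) = lW w ∘ π₁
  lW (snoc🔒 w) = μ ∘ ◇₁ (lW w)

  ⟦_⟧var : ∀ {Γ A} → Var Γ A → ⟦ Γ ⟧ctx ⇒ ⟦ A ⟧ty
  ⟦ here ⟧var = π₂
  ⟦ there v ⟧var = ⟦ v ⟧var ∘ π₁

  ⟦_⟧ : ∀ {Γ A} → Γ ⊢ A → ⟦ Γ ⟧ctx ⇒ ⟦ A ⟧ty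
  ⟦ var v ⟧ = ⟦ v ⟧var
  ⟦ unit ⟧ = !
  ⟦ pair D E ⟧ = ⟨ ⟦ D ⟧ , ⟦ E ⟧ ⟩
  ⟦ fst D ⟧ = π₁ ∘ ⟦ D ⟧
  ⟦ snd D ⟧ = π₂ ∘ ⟦ D ⟧
  ⟦ lam D ⟧ = curry ⟦ D ⟧
  ⟦ app D E ⟧ = eval ∘ ⟨ ⟦ D ⟧ , ⟦ E ⟧ ⟩
  ⟦ shut D ⟧ = □₁ ⟦ D ⟧ ∘ ηᵐ
  ⟦ opn w D ⟧ = εᵐ ∘ (◇₁ ⟦ D ⟧ ∘ lW w)

-- Strengthening is tracked by a logical relation (Agree) between the denotations of D
-- and of its strengthening D'; every term former preserves it because the morphisms
-- interpreting term formers are natural in the context.  With nothing to the right of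
-- the deleted context Δ, the relation yields η ∘ ⟦D⟧ = ◇⟦D'⟧ ∘ l_Δ (the lock case is
-- where idempotence, ◇η = η◇, enters), and applying μ ∘ ◇(-) together with
-- l_{Δ,Γ''} = μ ∘ ◇l_Δ ∘ l_{Γ''} gives the theorem.
module Submission where

open import Defs
open import Level using (_⊔_)
open import Data.Nat using (ℕ)
open import Data.Product using (_,_; proj₁; proj₂)
open import Data.Sum using (inj₁; inj₂)
open import Data.Empty using (⊥-elim)
open import Relation.Nullary using (¬_)
open import Relation.Binary.PropositionalEquality using (refl; _≢_)
open import Relation.Binary.Structures using (IsEquivalence)
open import Relation.Binary.Bundles using (Setoid)
import Relation.Binary.Reasoning.Setoid as SetoidReasoning

module ModelProperties {o ℓ e} (M : Model o ℓ e) where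
  open Model M

  module _ {A B : Obj} where
    open IsEquivalence (≈-equiv {A} {B}) public
      using () renaming (refl to ≈-refl; sym to ≈-sym; trans to ≈-trans)

  hom-setoid : Obj → Obj → Setoid ℓ e
  hom-setoid A B = record { isEquivalence = ≈-equiv {A} {B} }

  module HomReasoning {A B : Obj} = SetoidReasoning (hom-setoid A B)
  open HomReasoning public

  infixr 4 _⟩∘⟨_ refl⟩∘⟨_
  infixl 5 _⟩∘⟨refl

  _⟩∘⟨_ : ∀ {A B C} {f h : B ⇒ C} {g i : A ⇒ B} → f ≈ h → g ≈ i → f ∘ g ≈ h ∘ i
  _⟩∘⟨_ = ∘-resp-≈

  refl⟩∘⟨_ : ∀ {A B C} {f : B ⇒ C} {g i : A ⇒ B} → g ≈ i → f ∘ g ≈ f ∘ i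
  refl⟩∘⟨ p = ≈-refl ⟩∘⟨ p

  _⟩∘⟨refl : ∀ {A B C} {f h : B ⇒ C} {g : A ⇒ B} → f ≈ h → f ∘ g ≈ h ∘ g
  p ⟩∘⟨refl = p ⟩∘⟨ ≈-refl

  first : ∀ {A A' B} → A ⇒ A' → A × B ⇒ A' × B
  first f = ⟨ f ∘ π₁ , π₂ ⟩

  ⟨⟩∘ : ∀ {A B C D} {f : C ⇒ A} {g : C ⇒ B} {h : D ⇒ C} → ⟨ f , g ⟩ ∘ h ≈ ⟨ f ∘ h , g ∘ h ⟩
  ⟨⟩∘ = ≈-sym (⟨⟩-unique (≈-trans (≈-sym assoc) (project₁ ⟩∘⟨refl))
                         (≈-trans (≈-sym assoc) (project₂ ⟩∘⟨refl)))

  ⟨⟩-cong : ∀ {A B C} {f f' : C ⇒ A} {g g' : C ⇒ B} → f ≈ f' → g ≈ g' → ⟨ f , g ⟩ ≈ ⟨ f' , g' ⟩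
  ⟨⟩-cong p q = ⟨⟩-unique (≈-trans project₁ (≈-sym p)) (≈-trans project₂ (≈-sym q))

  π₁∘first : ∀ {A A' B} {f : A ⇒ A'} → π₁ {B = B} ∘ first f ≈ f ∘ π₁
  π₁∘first = project₁

  curry-cong : ∀ {A B C} {f f' : A × B ⇒ C} → f ≈ f' → curry f ≈ curry f'
  curry-cong p = curry-unique (≈-trans β (≈-sym p))

  curry-natural : ∀ {A A' B C} {g : A × B ⇒ C} {f : A' ⇒ A} → curry (g ∘ first f) ≈ curry g ∘ f
  curry-natural {g = g} {f} = curry-unique (begin
    eval ∘ ⟨ (curry g ∘ f) ∘ π₁ , π₂ ⟩                  ≈⟨ refl⟩∘⟨ ⟨⟩-cong shift (≈-sym project₂) ⟩
    eval ∘ ⟨ (curry g ∘ π₁) ∘ first f , π₂ ∘ first f ⟩ ≈⟨ refl⟩∘⟨ ⟨⟩∘ ⟨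
    eval ∘ (⟨ curry g ∘ π₁ , π₂ ⟩ ∘ first f)            ≈⟨ assoc ⟨
    (eval ∘ ⟨ curry g ∘ π₁ , π₂ ⟩) ∘ first f            ≈⟨ β ⟩∘⟨refl ⟩
    g ∘ first f                                         ∎)
    where
    shift : (curry g ∘ f) ∘ π₁ ≈ (curry g ∘ π₁) ∘ first f
    shift = ≈-trans assoc (≈-trans (refl⟩∘⟨ ≈-sym π₁∘first) (≈-sym assoc))

  shut-natural : ∀ {A A' C} {g : ◇ A ⇒ C} {f : A' ⇒ A} → □₁ (g ∘ ◇₁ f) ∘ ηᵐ ≈ (□₁ g ∘ ηᵐ) ∘ f
  shut-natural {g = g} {f} = begin
    □₁ (g ∘ ◇₁ f) ∘ ηᵐ      ≈⟨ □-homomorphism ⟩∘⟨refl ⟩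
    (□₁ g ∘ □₁ (◇₁ f)) ∘ ηᵐ ≈⟨ assoc ⟩
    □₁ g ∘ (□₁ (◇₁ f) ∘ ηᵐ) ≈⟨ refl⟩∘⟨ ηᵐ-natural ⟨
    □₁ g ∘ (ηᵐ ∘ f)         ≈⟨ assoc ⟨
    (□₁ g ∘ ηᵐ) ∘ f         ∎

  η-natural : ∀ {X Y} {f : X ⇒ Y} → η ∘ f ≈ ◇₁ f ∘ η
  η-natural {f = f} = begin
    (ε ∘ ηᵐ) ∘ f         ≈⟨ assoc ⟩
    ε ∘ (ηᵐ ∘ f)         ≈⟨ refl⟩∘⟨ ηᵐ-natural ⟩
    ε ∘ (□₁ (◇₁ f) ∘ ηᵐ) ≈⟨ assoc ⟨
    (ε ∘ □₁ (◇₁ f)) ∘ ηᵐ ≈⟨ ε-natural ⟩∘⟨refl ⟩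
    (◇₁ f ∘ ε) ∘ ηᵐ      ≈⟨ assoc ⟩
    ◇₁ f ∘ (ε ∘ ηᵐ)      ∎

module IdempotentProperties {o ℓ e} (M : Model o ℓ e) (idem : IsIdempotent M) where
  open Model M
  open ModelProperties M

  μ∘η≈id : ∀ {X} → μ {X} ∘ η {◇ X} ≈ id
  μ∘η≈id = proj₁ idem

  η∘μ≈id : ∀ {X} → η {◇ X} ∘ μ {X} ≈ id
  η∘μ≈id = proj₁ (proj₂ idem)

  ◇₁η≈η : ∀ {X} → ◇₁ (η {X}) ≈ η {◇ X}
  ◇₁η≈η = proj₂ (proj₂ idem)

  μ∘◇₁η≈id : ∀ {X} → μ ∘ ◇₁ (η {X}) ≈ id
  μ∘◇₁η≈id = ≈-trans (refl⟩∘⟨ ◇₁η≈η) μ∘η≈id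

  -- μ is invertible, so it commutes with anything that commutes with its inverse η.
  μ-commute : ∀ {A B} {x : ◇ (◇ A) ⇒ ◇ (◇ B)} {y : ◇ A ⇒ ◇ B} → x ∘ η ≈ η ∘ y → μ ∘ x ≈ y ∘ μ
  μ-commute {x = x} {y} xη≈ηy = begin
    μ ∘ x               ≈⟨ identityʳ ⟨
    (μ ∘ x) ∘ id        ≈⟨ refl⟩∘⟨ η∘μ≈id ⟨
    (μ ∘ x) ∘ (η ∘ μ)   ≈⟨ assoc ⟩
    μ ∘ (x ∘ (η ∘ μ))   ≈⟨ refl⟩∘⟨ assoc ⟨
    μ ∘ ((x ∘ η) ∘ μ)   ≈⟨ refl⟩∘⟨ xη≈ηy ⟩∘⟨refl ⟩
    μ ∘ ((η ∘ y) ∘ μ)   ≈⟨ refl⟩∘⟨ assoc ⟩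
    μ ∘ (η ∘ (y ∘ μ))   ≈⟨ assoc ⟨
    (μ ∘ η) ∘ (y ∘ μ)   ≈⟨ μ∘η≈id ⟩∘⟨refl ⟩
    id ∘ (y ∘ μ)        ≈⟨ identityˡ ⟩
    y ∘ μ               ∎

  μ-natural : ∀ {X Y} {f : X ⇒ Y} → μ ∘ ◇₁ (◇₁ f) ≈ ◇₁ f ∘ μ
  μ-natural = μ-commute (≈-sym η-natural)

  μ-assoc : ∀ {X} → μ {X} ∘ ◇₁ (μ {X}) ≈ μ ∘ μ {◇ X}
  μ-assoc = μ-commute (≈-sym η-natural)

  μ∘◇₁[◇₁f∘g]≈◇₁f∘μ∘◇₁g : ∀ {X Y Z} {f : X ⇒ Y} {g : Z ⇒ ◇ X}
                         → μ ∘ ◇₁ (◇₁ f ∘ g) ≈ ◇₁ f ∘ (μ ∘ ◇₁ g)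
  μ∘◇₁[◇₁f∘g]≈◇₁f∘μ∘◇₁g {f = f} {g} = begin
    μ ∘ ◇₁ (◇₁ f ∘ g)      ≈⟨ refl⟩∘⟨ ◇-homomorphism ⟩
    μ ∘ (◇₁ (◇₁ f) ∘ ◇₁ g) ≈⟨ assoc ⟨
    (μ ∘ ◇₁ (◇₁ f)) ∘ ◇₁ g ≈⟨ μ-natural ⟩∘⟨refl ⟩
    (◇₁ f ∘ μ) ∘ ◇₁ g      ≈⟨ assoc ⟩
    ◇₁ f ∘ (μ ∘ ◇₁ g)      ∎

  μ∘◇₁[η∘f]≈◇₁f : ∀ {X Y} {f : X ⇒ Y} → μ ∘ ◇₁ (η ∘ f) ≈ ◇₁ f
  μ∘◇₁[η∘f]≈◇₁f {f = f} = begin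
    μ ∘ ◇₁ (η ∘ f)      ≈⟨ refl⟩∘⟨ ◇-homomorphism ⟩
    μ ∘ (◇₁ η ∘ ◇₁ f)   ≈⟨ assoc ⟨
    (μ ∘ ◇₁ η) ∘ ◇₁ f   ≈⟨ μ∘◇₁η≈id ⟩∘⟨refl ⟩
    id ∘ ◇₁ f           ≈⟨ identityˡ ⟩
    ◇₁ f                ∎

  ◇₁[f∘η]≈η∘f : ∀ {X Y} {f : ◇ X ⇒ Y} → ◇₁ (f ∘ η) ≈ η ∘ f
  ◇₁[f∘η]≈η∘f {f = f} = begin
    ◇₁ (f ∘ η)   ≈⟨ ◇-homomorphism ⟩
    ◇₁ f ∘ ◇₁ η  ≈⟨ refl⟩∘⟨ ◇₁η≈η ⟩
    ◇₁ f ∘ η     ≈⟨ η-natural ⟨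
    η ∘ f        ∎

  μ∘◇₁f∘η≈f : ∀ {X Y} {f : X ⇒ ◇ Y} → (μ ∘ ◇₁ f) ∘ η ≈ f
  μ∘◇₁f∘η≈f {f = f} = begin
    (μ ∘ ◇₁ f) ∘ η ≈⟨ assoc ⟩
    μ ∘ (◇₁ f ∘ η) ≈⟨ refl⟩∘⟨ η-natural ⟨
    μ ∘ (η ∘ f)    ≈⟨ assoc ⟨
    (μ ∘ η) ∘ f    ≈⟨ μ∘η≈id ⟩∘⟨refl ⟩
    id ∘ f         ≈⟨ identityˡ ⟩
    f              ∎

module Strengthening {o ℓ e} (M : Model o ℓ e) (idem : IsIdempotent M) (P : ℕ → Model.Obj M) where
  open Model M
  open Sem M P
  open ModelProperties M
  open IdempotentProperties M idem

  append : ∀ Θ Γ₀ → Append Θ Γ₀ (Θ ,, Γ₀)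
  append Θ ∅ = nil
  append Θ (Γ₀ ▹ A) = snoc (append Θ Γ₀)
  append Θ (Γ₀ ,🔒) = snoc🔒 (append Θ Γ₀)

  -- The action on morphisms of the endofunctor ⟦ Γ₀ ⟧F, read through ⟦ Θ ,, Γ₀ ⟧ = ⟦ Γ₀ ⟧F ⟦ Θ ⟧.
  ⟦_⟧F₁ : ∀ Γ₀ {Θ Θ'} → ⟦ Θ ⟧ctx ⇒ ⟦ Θ' ⟧ctx → ⟦ Θ ,, Γ₀ ⟧ctx ⇒ ⟦ Θ' ,, Γ₀ ⟧ctx
  ⟦ ∅ ⟧F₁ f = f
  ⟦ Γ₀ ▹ A ⟧F₁ f = first (⟦ Γ₀ ⟧F₁ f)
  ⟦ Γ₀ ,🔒 ⟧F₁ f = ◇₁ (⟦ Γ₀ ⟧F₁ f)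

  -- Agree w Γ₀ f g, where w appends Δ: f : ⟦ Γ,Δ,Γ₀ ⟧ ⇒ Y does not depend on the variables
  -- of Δ and, once the locks of Δ are filled by η, is g : ⟦ Γ,Γ₀ ⟧ ⇒ Y.
  data Agree {Y : Obj} : ∀ {Γ Δ Θ} → Append Γ Δ Θ → ∀ Γ₀
                       → ⟦ Θ ,, Γ₀ ⟧ctx ⇒ Y → ⟦ Γ ,, Γ₀ ⟧ctx ⇒ Y → Set (ℓ ⊔ e) where
    nil    : ∀ {Γ Γ₀ f g} → f ≈ g → Agree (nil {Γ}) Γ₀ f g
    snoc   : ∀ {Γ Δ Θ A Γ₀ f g} {w : Append Γ Δ Θ} (h : ⟦ Θ ,, Γ₀ ⟧ctx ⇒ Y)
           → f ≈ h ∘ ⟦ Γ₀ ⟧F₁ π₁ → Agree w Γ₀ h g → Agree (snoc {A = A} w) Γ₀ f g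
    snoc🔒 : ∀ {Γ Δ Θ Γ₀ f g} {w : Append Γ Δ Θ}
           → Agree w Γ₀ (f ∘ ⟦ Γ₀ ⟧F₁ η) g → Agree (snoc🔒 w) Γ₀ f g

  Agree-resp : ∀ {Γ Δ Θ Γ₀ Y} {w : Append Γ Δ Θ}
      {f f' : ⟦ Θ ,, Γ₀ ⟧ctx ⇒ Y} {g g' : ⟦ Γ ,, Γ₀ ⟧ctx ⇒ Y}
      → f ≈ f' → g ≈ g' → Agree w Γ₀ f g → Agree w Γ₀ f' g'
  Agree-resp p q (nil r) = nil (≈-trans (≈-sym p) (≈-trans r q))
  Agree-resp p q (snoc h r a) = snoc h (≈-trans (≈-sym p) r) (Agree-resp ≈-refl q a)
  Agree-resp p q (snoc🔒 a) = snoc🔒 (Agree-resp (p ⟩∘⟨refl) q a)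

  Agree-map : ∀ {Γ Δ Θ Γ₀ Γ₁ Y Y'} {w : Append Γ Δ Θ}
              {f : ⟦ Θ ,, Γ₀ ⟧ctx ⇒ Y} {g : ⟦ Γ ,, Γ₀ ⟧ctx ⇒ Y}
            → (F : ∀ {Φ} → ⟦ Φ ,, Γ₀ ⟧ctx ⇒ Y → ⟦ Φ ,, Γ₁ ⟧ctx ⇒ Y')
            → (∀ {Φ} {h h' : ⟦ Φ ,, Γ₀ ⟧ctx ⇒ Y} → h ≈ h' → F {Φ} h ≈ F {Φ} h')
            → (∀ {Φ Φ'} {h : ⟦ Φ' ,, Γ₀ ⟧ctx ⇒ Y} {L : ⟦ Φ ⟧ctx ⇒ ⟦ Φ' ⟧ctx}
               → F {Φ} (h ∘ ⟦ Γ₀ ⟧F₁ {Φ} {Φ'} L) ≈ F {Φ'} h ∘ ⟦ Γ₁ ⟧F₁ {Φ} {Φ'} L)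
            → Agree w Γ₀ f g → Agree w Γ₁ (F f) (F g)
  Agree-map F F-cong F-natural (nil r) = nil (F-cong r)
  Agree-map F F-cong F-natural (snoc h r a) =
    snoc (F h) (≈-trans (F-cong r) F-natural) (Agree-map F F-cong F-natural a)
  Agree-map F F-cong F-natural (snoc🔒 a) =
    snoc🔒 (Agree-resp F-natural ≈-refl (Agree-map F F-cong F-natural a))

  Agree-⟨⟩ : ∀ {Γ Δ Θ Γ₀ Y Y'} {w : Append Γ Δ Θ}
      {f₁ : ⟦ Θ ,, Γ₀ ⟧ctx ⇒ Y} {g₁ : ⟦ Γ ,, Γ₀ ⟧ctx ⇒ Y}
      {f₂ : ⟦ Θ ,, Γ₀ ⟧ctx ⇒ Y'} {g₂ : ⟦ Γ ,, Γ₀ ⟧ctx ⇒ Y'}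
      → Agree w Γ₀ f₁ g₁ → Agree w Γ₀ f₂ g₂ → Agree w Γ₀ ⟨ f₁ , f₂ ⟩ ⟨ g₁ , g₂ ⟩
  Agree-⟨⟩ (nil r) (nil s) = nil (⟨⟩-cong r s)
  Agree-⟨⟩ (snoc h r a) (snoc h' s b) =
    snoc ⟨ h , h' ⟩ (≈-trans (⟨⟩-cong r s) (≈-sym ⟨⟩∘)) (Agree-⟨⟩ a b)
  Agree-⟨⟩ (snoc🔒 a) (snoc🔒 b) = snoc🔒 (Agree-resp (≈-sym ⟨⟩∘) ≈-refl (Agree-⟨⟩ a b))

  Agree-uniform : ∀ {Γ Δ Θ Γ₀ Y} {w : Append Γ Δ Θ} (c : ∀ {Φ} → ⟦ Φ ,, Γ₀ ⟧ctx ⇒ Y)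
                → (∀ {Φ Φ'} {L : ⟦ Φ ⟧ctx ⇒ ⟦ Φ' ⟧ctx} → c {Φ'} ∘ ⟦ Γ₀ ⟧F₁ {Φ} {Φ'} L ≈ c {Φ})
                → Agree w Γ₀ c c
  Agree-uniform {w = nil} c c-natural = nil ≈-refl
  Agree-uniform {w = snoc w} c c-natural = snoc c (≈-sym c-natural) (Agree-uniform c c-natural)
  Agree-uniform {w = snoc🔒 w} c c-natural =
    snoc🔒 (Agree-resp (≈-sym c-natural) ≈-refl (Agree-uniform c c-natural))

  Agree-∘ : ∀ {Γ Δ Θ Γ₀ Y Y'} {w : Append Γ Δ Θ}
      {f : ⟦ Θ ,, Γ₀ ⟧ctx ⇒ Y} {g : ⟦ Γ ,, Γ₀ ⟧ctx ⇒ Y} (k : Y ⇒ Y')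
      → Agree w Γ₀ f g → Agree w Γ₀ (k ∘ f) (k ∘ g)
  Agree-∘ k = Agree-map (k ∘_) (refl⟩∘⟨_) (≈-sym assoc)

  Agree-weaken : ∀ {Γ Δ Θ Γ₀ A Y} {w : Append Γ Δ Θ}
      {f : ⟦ Θ ,, Γ₀ ⟧ctx ⇒ Y} {g : ⟦ Γ ,, Γ₀ ⟧ctx ⇒ Y}
      → Agree w Γ₀ f g → Agree w (Γ₀ ▹ A) (f ∘ π₁) (g ∘ π₁)
  Agree-weaken = Agree-map (_∘ π₁) (_⟩∘⟨refl)
    (≈-trans assoc (≈-trans (refl⟩∘⟨ ≈-sym π₁∘first) (≈-sym assoc)))

  Agree-◇₁ : ∀ {Γ Δ Θ Γ₀ Y} {w : Append Γ Δ Θ}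
      {f : ⟦ Θ ,, Γ₀ ⟧ctx ⇒ Y} {g : ⟦ Γ ,, Γ₀ ⟧ctx ⇒ Y}
      → Agree w Γ₀ f g → Agree w (Γ₀ ,🔒) (◇₁ f) (◇₁ g)
  Agree-◇₁ = Agree-map ◇₁ ◇-resp-≈ ◇-homomorphism

  Agree-curry : ∀ {Γ Δ Θ Γ₀ A Y} {w : Append Γ Δ Θ}
      {f : ⟦ Θ ,, Γ₀ ▹ A ⟧ctx ⇒ Y} {g : ⟦ Γ ,, Γ₀ ▹ A ⟧ctx ⇒ Y}
      → Agree w (Γ₀ ▹ A) f g → Agree w Γ₀ (curry f) (curry g)
  Agree-curry = Agree-map curry curry-cong curry-natural

  Agree-shut : ∀ {Γ Δ Θ Γ₀ Y} {w : Append Γ Δ Θ}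
      {f : ⟦ Θ ,, Γ₀ ,🔒 ⟧ctx ⇒ Y} {g : ⟦ Γ ,, Γ₀ ,🔒 ⟧ctx ⇒ Y}
      → Agree w (Γ₀ ,🔒) f g → Agree w Γ₀ (□₁ f ∘ ηᵐ) (□₁ g ∘ ηᵐ)
  Agree-shut = Agree-map (λ h → □₁ h ∘ ηᵐ) (λ p → □-resp-≈ p ⟩∘⟨refl) shut-natural

  Agree-var : ∀ {Γ Δ Θ A} (w : Append Γ Δ Θ) Γ₀ (v : Var (Θ ,, Γ₀) A)
            → (nf : ∀ p → toPos v ≢ inL (append Θ Γ₀) (inR w p))
            → Agree w Γ₀ ⟦ v ⟧var ⟦ strVar w (append Θ Γ₀) v nf ⟧var
  Agree-var nil ∅ v nf = nil ≈-refl
  Agree-var (snoc w) ∅ here nf = ⊥-elim (nf here refl)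
  Agree-var (snoc w) ∅ (there v) nf = snoc ⟦ v ⟧var ≈-refl (Agree-var w ∅ v _)
  Agree-var w (Γ₀ ▹ B) here nf = Agree-uniform π₂ project₂
  Agree-var w (Γ₀ ▹ B) (there v) nf = Agree-weaken (Agree-var w Γ₀ v _)

  ⟦_⟧open : ∀ {Φ A} → OpenData Φ A → ⟦ Φ ⟧ctx ⇒ ◇ (□ ⟦ A ⟧ty)
  ⟦ _ , _ , w , D ⟧open = ◇₁ ⟦ D ⟧ ∘ lW w

  Agree-strengthen : ∀ {Γ Δ Θ A} (w : Append Γ Δ Θ) Γ₀ (D : Θ ,, Γ₀ ⊢ A)
                   → (nf : ∀ p → ¬ Free D (inL (append Θ Γ₀) (inR w p)))
                   → Agree w Γ₀ ⟦ D ⟧ ⟦ strengthen w (append Θ Γ₀) D nf ⟧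
  Agree-strOpen : ∀ {Γ Δ Θ Γ₁ Γ₁' A} (w : Append Γ Δ Θ) Γ₀
                  (v : Append Γ₁ Γ₁' (Θ ,, Γ₀)) (D : Γ₁ ⊢ □ₜ A)
                → (nf : ∀ p → ¬ Free (opn v D) (inL (append Θ Γ₀) (inR w p)))
                → Agree w Γ₀ (◇₁ ⟦ D ⟧ ∘ lW v) ⟦ strOpen w (append Θ Γ₀) v D nf ⟧open

  Agree-strengthen w Γ₀ (var v) nf = Agree-var w Γ₀ v nf
  Agree-strengthen w Γ₀ unit nf = Agree-uniform ! (≈-sym (!-unique _))
  Agree-strengthen w Γ₀ (pair D E) nf =
    Agree-⟨⟩ (Agree-strengthen w Γ₀ D (λ p u → nf p (inj₁ u)))
             (Agree-strengthen w Γ₀ E (λ p u → nf p (inj₂ u)))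
  Agree-strengthen w Γ₀ (fst D) nf = Agree-∘ π₁ (Agree-strengthen w Γ₀ D nf)
  Agree-strengthen w Γ₀ (snd D) nf = Agree-∘ π₂ (Agree-strengthen w Γ₀ D nf)
  Agree-strengthen w Γ₀ (lam D) nf = Agree-curry (Agree-strengthen w (Γ₀ ▹ _) D nf)
  Agree-strengthen w Γ₀ (app D E) nf =
    Agree-∘ eval (Agree-⟨⟩ (Agree-strengthen w Γ₀ D (λ p u → nf p (inj₁ u)))
                           (Agree-strengthen w Γ₀ E (λ p u → nf p (inj₂ u))))
  Agree-strengthen w Γ₀ (shut D) nf = Agree-shut (Agree-strengthen w (Γ₀ ,🔒) D nf)
  -- Matching on the result of strOpen is what lets the with-clauses of strengthen reduce.
  Agree-strengthen {Θ = Θ} w Γ₀ (opn v D) nf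
    with strOpen w (append Θ Γ₀) v D nf | Agree-strOpen w Γ₀ v D nf
  ... | _ , _ , _ , _ | a = Agree-∘ εᵐ a

  Agree-strOpen {Θ = Θ} w (Γ₀ ▹ B) (snoc v) D nf
    with strOpen w (append Θ Γ₀) v D nf | Agree-strOpen w Γ₀ v D nf
  ... | _ , _ , _ , _ | a = Agree-resp assoc assoc (Agree-weaken a)
  Agree-strOpen {Θ = Θ} w (Γ₀ ,🔒) (snoc🔒 v) D nf
    with strOpen w (append Θ Γ₀) v D nf | Agree-strOpen w Γ₀ v D nf
  ... | _ , _ , _ , _ | a =
    Agree-resp μ∘◇₁[◇₁f∘g]≈◇₁f∘μ∘◇₁g μ∘◇₁[◇₁f∘g]≈◇₁f∘μ∘◇₁g (Agree-∘ μ (Agree-◇₁ a))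
  Agree-strOpen w Γ₀ nil D nf =
    Agree-resp η-natural η-natural (Agree-∘ η (Agree-strengthen w Γ₀ D nf))
  Agree-strOpen nil ∅ (snoc v) D nf = nil ≈-refl
  Agree-strOpen nil ∅ (snoc🔒 v) D nf = nil ≈-refl
  Agree-strOpen (snoc w) ∅ (snoc v) D nf =
    snoc _ (≈-sym assoc) (Agree-strOpen w ∅ v D (λ p → nf (there p)))
  Agree-strOpen (snoc🔒 w) ∅ (snoc🔒 v) D nf =
    snoc🔒 (Agree-resp (≈-trans (refl⟩∘⟨ ≈-sym μ∘◇₁f∘η≈f) (≈-sym assoc)) ≈-refl
                       (Agree-strOpen w ∅ v D (λ p → nf (there🔒 p))))

  Agree⇒η∘≈◇₁∘lW : ∀ {Γ Δ Θ Y} {w : Append Γ Δ Θ} {f : ⟦ Θ ⟧ctx ⇒ Y} {g}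
                 → Agree w ∅ f g → η ∘ f ≈ ◇₁ g ∘ lW w
  Agree⇒η∘≈◇₁∘lW (nil r) = ≈-trans (refl⟩∘⟨ r) η-natural
  Agree⇒η∘≈◇₁∘lW {w = snoc w} {f} {g} (snoc h r a) = begin
    η ∘ f               ≈⟨ refl⟩∘⟨ r ⟩
    η ∘ (h ∘ π₁)        ≈⟨ assoc ⟨
    (η ∘ h) ∘ π₁        ≈⟨ Agree⇒η∘≈◇₁∘lW a ⟩∘⟨refl ⟩
    (◇₁ g ∘ lW w) ∘ π₁  ≈⟨ assoc ⟩
    ◇₁ g ∘ (lW w ∘ π₁)  ∎
  Agree⇒η∘≈◇₁∘lW {w = snoc🔒 w} {f} {g} (snoc🔒 a) = begin
    η ∘ f                  ≈⟨ ◇₁[f∘η]≈η∘f ⟨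
    ◇₁ (f ∘ η)             ≈⟨ μ∘◇₁[η∘f]≈◇₁f ⟨
    μ ∘ ◇₁ (η ∘ (f ∘ η))   ≈⟨ refl⟩∘⟨ ◇-resp-≈ (Agree⇒η∘≈◇₁∘lW a) ⟩
    μ ∘ ◇₁ (◇₁ g ∘ lW w)   ≈⟨ μ∘◇₁[◇₁f∘g]≈◇₁f∘μ∘◇₁g ⟩
    ◇₁ g ∘ (μ ∘ ◇₁ (lW w)) ∎

  lW-append-trans : ∀ {Γ Γ' Γ'' Ψ₁ Ψ} (w₁ : Append Γ Γ' Ψ₁) (w₂ : Append Ψ₁ Γ'' Ψ)
                  → lW (append-trans w₁ w₂) ≈ (μ ∘ ◇₁ (lW w₁)) ∘ lW w₂
  lW-append-trans w₁ nil = ≈-sym μ∘◇₁f∘η≈f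
  lW-append-trans w₁ (snoc w₂) = ≈-trans (lW-append-trans w₁ w₂ ⟩∘⟨refl) assoc
  lW-append-trans w₁ (snoc🔒 w₂) = begin
    μ ∘ ◇₁ (lW (append-trans w₁ w₂))     ≈⟨ refl⟩∘⟨ ◇-resp-≈ (lW-append-trans w₁ w₂) ⟩
    μ ∘ ◇₁ ((μ ∘ ◇₁ (lW w₁)) ∘ lW w₂)    ≈⟨ refl⟩∘⟨ ◇-homomorphism ⟩
    μ ∘ (◇₁ (μ ∘ ◇₁ (lW w₁)) ∘ ◇₁ (lW w₂)) ≈⟨ assoc ⟨
    (μ ∘ ◇₁ (μ ∘ ◇₁ (lW w₁))) ∘ ◇₁ (lW w₂) ≈⟨ μ∘◇₁[μ∘◇₁f] ⟩∘⟨refl ⟩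
    ((μ ∘ ◇₁ (lW w₁)) ∘ μ) ∘ ◇₁ (lW w₂)    ≈⟨ assoc ⟩
    (μ ∘ ◇₁ (lW w₁)) ∘ (μ ∘ ◇₁ (lW w₂))    ∎
    where
    μ∘◇₁[μ∘◇₁f] : μ ∘ ◇₁ (μ ∘ ◇₁ (lW w₁)) ≈ (μ ∘ ◇₁ (lW w₁)) ∘ μ
    μ∘◇₁[μ∘◇₁f] = begin
      μ ∘ ◇₁ (μ ∘ ◇₁ (lW w₁))        ≈⟨ refl⟩∘⟨ ◇-homomorphism ⟩
      μ ∘ (◇₁ μ ∘ ◇₁ (◇₁ (lW w₁)))   ≈⟨ assoc ⟨
      (μ ∘ ◇₁ μ) ∘ ◇₁ (◇₁ (lW w₁))   ≈⟨ μ-assoc ⟩∘⟨refl ⟩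
      (μ ∘ μ) ∘ ◇₁ (◇₁ (lW w₁))      ≈⟨ assoc ⟩
      μ ∘ (μ ∘ ◇₁ (◇₁ (lW w₁)))      ≈⟨ refl⟩∘⟨ μ-natural ⟩
      μ ∘ (◇₁ (lW w₁) ∘ μ)           ≈⟨ assoc ⟨
      (μ ∘ ◇₁ (lW w₁)) ∘ μ           ∎

lemma9 : ∀ {o ℓ e} (M : Model o ℓ e) → IsIdempotent M → (P : ℕ → Model.Obj M)
    → ∀ {Γ Γ' Γ'' Ψ₁ Ψ A} (w₁ : Append Γ Γ' Ψ₁) (w₂ : Append Ψ₁ Γ'' Ψ) (D : Ψ₁ ⊢ A)
    → (nf : ∀ p → ¬ Free D (inR w₁ p))
    → let open Model M in let open Sem M P in
    ◇₁ ⟦ D ⟧ ∘ lW w₂ ≈ ◇₁ ⟦ strengthen w₁ nil D nf ⟧ ∘ lW (append-trans w₁ w₂)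
lemma9 M idem P w₁ w₂ D nf = begin
  ◇₁ ⟦ D ⟧ ∘ lW w₂                              ≈⟨ μ∘◇₁[η∘f]≈◇₁f ⟩∘⟨refl ⟨
  (μ ∘ ◇₁ (η ∘ ⟦ D ⟧)) ∘ lW w₂                  ≈⟨ (refl⟩∘⟨ ◇-resp-≈ η∘⟦D⟧≈◇₁⟦D'⟧∘lW) ⟩∘⟨refl ⟩
  (μ ∘ ◇₁ (◇₁ ⟦ D' ⟧ ∘ lW w₁)) ∘ lW w₂          ≈⟨ μ∘◇₁[◇₁f∘g]≈◇₁f∘μ∘◇₁g ⟩∘⟨refl ⟩
  (◇₁ ⟦ D' ⟧ ∘ (μ ∘ ◇₁ (lW w₁))) ∘ lW w₂        ≈⟨ assoc ⟩
  ◇₁ ⟦ D' ⟧ ∘ ((μ ∘ ◇₁ (lW w₁)) ∘ lW w₂)        ≈⟨ refl⟩∘⟨ lW-append-trans w₁ w₂ ⟨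
  ◇₁ ⟦ D' ⟧ ∘ lW (append-trans w₁ w₂)           ∎
  where
  open Model M
  open Sem M P
  open ModelProperties M
  open IdempotentProperties M idem
  open Strengthening M idem P
  D' = strengthen w₁ nil D nf
  η∘⟦D⟧≈◇₁⟦D'⟧∘lW : η ∘ ⟦ D ⟧ ≈ ◇₁ ⟦ D' ⟧ ∘ lW w₁
  η∘⟦D⟧≈◇₁⟦D'⟧∘lW = Agree⇒η∘≈◇₁∘lW (Agree-strengthen w₁ ∅ D nf)
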